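{- Let $q\ge 2$ and $t\ge 2$ be integers and $s$ a positive integer. Then (1) $K_{q}((t-1)q,(t-1)q-t)\le q-2+CAN(t,(t-1)q,2)$; (2) $K_{q}^{RT}((t-1)q,s,(t-1)qs-t)\le K_{q}((t-1)q,(t-1)q-t)$; (3) $K_{q}^{RT}((t-1)q,s,(t-1)qs-t)\le q-2+CAN(t,(t-1)q,2)$.
   Context: For positive integers $m,s$, the RT poset $[m\times s]$ is $\{1,\dots,ms\}$ partitioned into blocks $B_i=\{is+1,\dots,(i+1)s\}$, $i=0,\dots,m-1$, each a chain $is+1\prec\cdots\prec(i+1)s$, with elements of different blocks incomparable. For $A\subseteq\{1,\dots,ms\}$, $\langle A\rangle$ is the smallest down-closed set containing $A$. For an integer $q\ge 2$, the RT distance on $\mathbb{Z}_q^{ms}$ is $d_{RT}(x,y)=|\langle\{i:x_i\ne y_i\}\rangle|$. A code $C\subseteq\mathbb{Z}_q^{ms}$ is an $R$-covering if for every $x\in\mathbb{Z}_q^{ms}$ there is $c\in C$ with $d_{RT}(x,c)\le R$; $K_q^{RT}(m,s,R)$ is the minimum size of an $R$-covering. $K_q(n,R)=K_q^{RT}(n,1,R)$ is the classical Hamming covering number (minimum size of a code in $\mathbb{Z}_q^n$ such that every word is within Hamming distance $R$ of a codeword). A covering array $CA(N;t,n,v)$ is an $N\times n$ array over an alphabet of size $v$ (with $2\le t\le n$) such that every set of $t$ columns contains every $t$-tuple over the alphabet as a row at least once; $CAN(t,n,v)$ is the smallest such $N$. -}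

module Defs where

open import Data.Nat using (ℕ; zero; suc; _+_; _≤_)
open import Data.Fin using (Fin; zero; suc; _≤_)
open import Data.Fin.Properties using (_≟_; any?)
open import Data.Bool using (Bool)
open import Data.Product using (Σ; ∃; _×_; _,_)
open import Data.Vec using (Vec; lookup)
open import Relation.Nullary using (¬_; Dec; does)
open import Relation.Nullary.Decidable using (¬?; _×-dec_)
open import Relation.Binary.PropositionalEquality using (_≡_)

count : ∀ {n} → (Fin n → Bool) → ℕ
count {zero} P = 0
count {suc n} P with P zero
... | Bool.true = suc (count (λ k → P (suc k)))
... | Bool.false = count (λ k → P (suc k))

Word : ℕ → ℕ → Set
Word q n = Fin n → Fin q

dH : ∀ {q n} → Word q n → Word q n → ℕ
dH x y = count (λ i → does (¬? (x i ≟ y i)))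

-- RT words: coordinate (i , j) is the j-th element (0-based) of block B_i,
-- i.e. element i*s + j + 1 of {1,...,ms}; chains are ordered by j.
RTWord : ℕ → ℕ → ℕ → Set
RTWord q m s = Fin m → Fin s → Fin q

-- (i , j) ∈ ⟨ {k : x_k ≠ y_k} ⟩  iff  some (i , j') with j ≤ j' lies in the support
inDownClosure : ∀ {q m s} → RTWord q m s → RTWord q m s → Fin m → Fin s → Bool
inDownClosure x y i j = does (any? (λ j' → Data.Fin._≤?_ j j' ×-dec ¬? (x i j' ≟ y i j')))

dRT : ∀ {q m s} → RTWord q m s → RTWord q m s → ℕ
dRT {m = m} x y = sumFin (λ i → count (inDownClosure x y i))
  where
  sumFin : ∀ {k} → (Fin k → ℕ) → ℕ
  sumFin {zero} f = 0
  sumFin {suc k} f = f zero + sumFin (λ i → f (suc i))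

HammingCovering : ℕ → ℕ → ℕ → ℕ → Set
HammingCovering q n R N =
  Σ (Vec (Word q n) N) λ C → ∀ (x : Word q n) → ∃ λ k → dH x (lookup C k) Data.Nat.≤ R

RTCovering : ℕ → ℕ → ℕ → ℕ → ℕ → Set
RTCovering q m s R N =
  Σ (Vec (RTWord q m s) N) λ C → ∀ (x : RTWord q m s) → ∃ λ k → dRT x (lookup C k) Data.Nat.≤ R

IsCoveringArray : ℕ → ℕ → ℕ → ℕ → Set
IsCoveringArray N t n v =
  Σ (Fin N → Fin n → Fin v) λ A →
    ∀ (cols : Fin t → Fin n) →
    (∀ a b → cols a ≡ cols b → a ≡ b) →
    ∀ (u : Fin t → Fin v) → ∃ λ r → ∀ k → A r (cols k) ≡ u k

IsMinimum : (ℕ → Set) → ℕ → Set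
IsMinimum P n = P n × (∀ m → P m → n Data.Nat.≤ m)

IsKq : ℕ → ℕ → ℕ → ℕ → Set
IsKq q n R = IsMinimum (HammingCovering q n R)

IsKqRT : ℕ → ℕ → ℕ → ℕ → ℕ → Set
IsKqRT q m s R = IsMinimum (RTCovering q m s R)

IsCAN : ℕ → ℕ → ℕ → ℕ → Set
IsCAN t n v = IsMinimum (λ N → IsCoveringArray N t n v)

{-# OPTIONS --safe #-}
module Submission where

-- Part (1): split ℤ_q into the q - 1 classes {0,1}, {2}, …, {q-1}. A word of length n = (t-1)q
-- has, by pigeonhole, t coordinates in one class. If that class is {a} with a ≥ 2, the constant
-- word a agrees with it there; if it is {0,1}, some row of a binary covering array of strength t
-- does. Either way the distance is at most n - t, so the q - 2 constant words together with the
-- rows of the array form an (n - t)-covering.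
-- Part (2), with m blocks of size s: spread every codeword of a Hamming covering constantly over
-- the blocks. If the top coordinates of x agree with a codeword c in t blocks, then those t blocks
-- lose their top element from the down-closure, so d_RT(x, c) ≤ ms - t.

open import Defs
open import Data.Bool using (Bool; true; false; not)
open import Data.Fin using (Fin; zero; suc; fromℕ; inject≤; _↑ˡ_; _↑ʳ_)
open import Data.Fin.Properties
  using (_≟_; any?; suc-injective; injective⇒≤; inject≤-injective; ≤fromℕ; ≤-antisym)
open import Data.Nat using (ℕ; zero; suc; _+_; _*_; _∸_; _≤_; _<_; z≤n; s≤s; _≤?_)
open import Data.Nat.Properties
  using ( module ≤-Reasoning; ≤-trans; <-≤-trans; ≮⇒≥; m≤n⇒m≤1+n; m<n+m; m≤m*n
        ; +-comm; +-suc; +-identityʳ; +-mono-≤; +-monoˡ-≤; +-cancelˡ-<; *-comm; *-suc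
        ; ∸-monoʳ-≤; m+n∸n≡m; m+n∸m≡n; m+n≤o⇒m≤o∸n; m∸[m∸n]≡n
        ; +-commutativeSemigroup; +-0-commutativeMonoid)
open import Algebra.Properties.CommutativeSemigroup +-commutativeSemigroup using (interchange)
open import Algebra.Properties.CommutativeMonoid.Sum +-0-commutativeMonoid
  using (sum; sum-cong-≗; ∑-distrib-+; sum-replicate-zero)
open import Data.Product using (∃; _×_; _,_)
open import Data.Sum using (_⊎_; inj₁; inj₂)
open import Data.Vec using (lookup; tabulate; _++_; map)
open import Data.Vec.Properties using (lookup-++ˡ; lookup-++ʳ; lookup∘tabulate; lookup-map)
open import Function using (_∘_)
open import Relation.Binary.PropositionalEquality
  using (_≡_; refl; sym; trans; cong; cong₂; subst; subst₂; module ≡-Reasoning)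
open import Relation.Nullary using (Dec; yes; no; does)
open import Relation.Nullary.Decidable using (¬?; _×-dec_; dec-true; dec-false)

does⇒ : ∀ {a} {A : Set a} (a? : Dec A) → does a? ≡ true → A
does⇒ (yes a) _ = a

indicator : Bool → ℕ
indicator true = 1
indicator false = 0

count-suc : ∀ {n} (P : Fin (suc n) → Bool) → count P ≡ indicator (P zero) + count (P ∘ suc)
count-suc P with P zero
... | true = refl
... | false = refl

count-≤ : ∀ {n} (P : Fin n → Bool) → count P ≤ n
count-≤ {zero} P = z≤n
count-≤ {suc n} P with P zero
... | true = s≤s (count-≤ (P ∘ suc))
... | false = m≤n⇒m≤1+n (count-≤ (P ∘ suc))

count-< : ∀ {n} (P : Fin n → Bool) k → P k ≡ false → count P < n
count-< {suc n} P zero Pk with P zero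
count-< {suc n} P zero () | true
... | false = s≤s (count-≤ (P ∘ suc))
count-< {suc n} P (suc k) Pk with P zero
... | true = s≤s (count-< (P ∘ suc) k Pk)
... | false = m≤n⇒m≤1+n (count-< (P ∘ suc) k Pk)

count-mono : ∀ {n} (P Q : Fin n → Bool) → (∀ k → P k ≡ true → Q k ≡ true) → count P ≤ count Q
count-mono {zero} P Q P⇒Q = z≤n
count-mono {suc n} P Q P⇒Q with P zero in P0 | Q zero in Q0
... | true | true = s≤s (count-mono (P ∘ suc) (Q ∘ suc) (P⇒Q ∘ suc))
... | true | false with () ← trans (sym (P⇒Q zero P0)) Q0
... | false | true = m≤n⇒m≤1+n (count-mono (P ∘ suc) (Q ∘ suc) (P⇒Q ∘ suc))
... | false | false = count-mono (P ∘ suc) (Q ∘ suc) (P⇒Q ∘ suc)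

count+count-not≡n : ∀ {n} (P : Fin n → Bool) → count P + count (not ∘ P) ≡ n
count+count-not≡n {zero} P = refl
count+count-not≡n {suc n} P with P zero
... | true = cong suc (count+count-not≡n (P ∘ suc))
... | false = trans (+-suc (count (P ∘ suc)) _) (cong suc (count+count-not≡n (P ∘ suc)))

enumerate : ∀ {n} (P : Fin n → Bool) → Fin (count P) → Fin n
enumerate {suc n} P i with P zero
enumerate {suc n} P zero | true = zero
enumerate {suc n} P (suc i) | true = suc (enumerate (P ∘ suc) i)
enumerate {suc n} P i | false = suc (enumerate (P ∘ suc) i)

enumerate-satisfies : ∀ {n} (P : Fin n → Bool) i → P (enumerate P i) ≡ true
enumerate-satisfies {suc n} P i with P zero in P0
enumerate-satisfies {suc n} P zero | true = P0
enumerate-satisfies {suc n} P (suc i) | true = enumerate-satisfies (P ∘ suc) i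
enumerate-satisfies {suc n} P i | false = enumerate-satisfies (P ∘ suc) i

enumerate-injective : ∀ {n} (P : Fin n → Bool) i j → enumerate P i ≡ enumerate P j → i ≡ j
enumerate-injective {suc n} P i j eq with P zero
enumerate-injective {suc n} P zero zero eq | true = refl
enumerate-injective {suc n} P (suc i) (suc j) eq | true =
  cong suc (enumerate-injective (P ∘ suc) i j (suc-injective eq))
enumerate-injective {suc n} P zero (suc j) () | true
enumerate-injective {suc n} P (suc i) zero () | true
enumerate-injective {suc n} P i j eq | false = enumerate-injective (P ∘ suc) i j (suc-injective eq)

rank : ∀ {n} (P : Fin n → Bool) k → P k ≡ true → Fin (count P)
rank {suc n} P zero Pk with P zero
rank {suc n} P zero Pk | true = zero
rank {suc n} P zero () | false
rank {suc n} P (suc k) Pk with P zero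
... | true = suc (rank (P ∘ suc) k Pk)
... | false = rank (P ∘ suc) k Pk

enumerate-rank : ∀ {n} (P : Fin n → Bool) k (Pk : P k ≡ true) → enumerate P (rank P k Pk) ≡ k
enumerate-rank {suc n} P zero Pk with P zero
enumerate-rank {suc n} P zero Pk | true = refl
enumerate-rank {suc n} P zero () | false
enumerate-rank {suc n} P (suc k) Pk with P zero
... | true = cong suc (enumerate-rank (P ∘ suc) k Pk)
... | false = cong suc (enumerate-rank (P ∘ suc) k Pk)

injection⇒≤count : ∀ {t n} (P : Fin n → Bool) (f : Fin t → Fin n) →
  (∀ a b → f a ≡ f b → a ≡ b) → (∀ a → P (f a) ≡ true) → t ≤ count P
injection⇒≤count P f f-injective f-satisfies = injective⇒≤ λ {a} {b} eq → f-injective a b (begin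
  f a                                        ≡⟨ sym (enumerate-rank P (f a) (f-satisfies a)) ⟩
  enumerate P (rank P (f a) (f-satisfies a)) ≡⟨ cong (enumerate P) eq ⟩
  enumerate P (rank P (f b) (f-satisfies b)) ≡⟨ enumerate-rank P (f b) (f-satisfies b) ⟩
  f b                                        ∎)
  where open ≡-Reasoning

≤count⇒injection : ∀ {t n} (P : Fin n → Bool) → t ≤ count P →
  ∃ λ (f : Fin t → Fin n) → (∀ a b → f a ≡ f b → a ≡ b) × (∀ a → P (f a) ≡ true)
≤count⇒injection P t≤count =
  enumerate P ∘ (λ a → inject≤ a t≤count) ,
  (λ a b eq → inject≤-injective t≤count t≤count a b (enumerate-injective P _ _ eq)) ,
  (λ a → enumerate-satisfies P _)

fiber : ∀ {n r} → (Fin n → Fin r) → Fin r → Fin n → Bool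
fiber f c i = does (f i ≟ c)

sum-indicator-≟ : ∀ {r} (a : Fin r) → sum (λ c → indicator (does (a ≟ c))) ≡ 1
sum-indicator-≟ {suc r} zero = cong suc (sum-replicate-zero r)
sum-indicator-≟ {suc r} (suc a) = sum-indicator-≟ a

sum-count-fiber : ∀ {n r} (f : Fin n → Fin r) → sum (λ c → count (fiber f c)) ≡ n
sum-count-fiber {zero} {r} f = sum-replicate-zero r
sum-count-fiber {suc n} {r} f = begin
  sum (λ c → count (fiber f c))
    ≡⟨ sum-cong-≗ (λ c → count-suc (fiber f c)) ⟩
  sum (λ c → indicator (does (f zero ≟ c)) + count (fiber (f ∘ suc) c))
    ≡⟨ ∑-distrib-+ (λ c → indicator (does (f zero ≟ c))) (λ c → count (fiber (f ∘ suc) c)) ⟩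
  sum (λ c → indicator (does (f zero ≟ c))) + sum (λ c → count (fiber (f ∘ suc) c))
    ≡⟨ cong₂ _+_ (sum-indicator-≟ (f zero)) (sum-count-fiber (f ∘ suc)) ⟩
  suc n ∎
  where open ≡-Reasoning

pigeonhole-sum : ∀ r b (g : Fin r → ℕ) → r * b < sum g → ∃ λ c → b < g c
pigeonhole-sum (suc r) b g r*b<sum with suc b ≤? g zero
... | yes b<g0 = zero , b<g0
... | no b≮g0 with pigeonhole-sum r b (g ∘ suc)
                     (+-cancelˡ-< b _ _ (<-≤-trans r*b<sum (+-monoˡ-≤ _ (≮⇒≥ b≮g0))))
... | c , b<gc = suc c , b<gc

fiber-pigeonhole : ∀ {n r} b (f : Fin n → Fin r) → r * b < n → ∃ λ c → b < count (fiber f c)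
fiber-pigeonhole {r = r} b f r*b<n =
  pigeonhole-sum r b (count ∘ fiber f) (subst (r * b <_) (sym (sum-count-fiber f)) r*b<n)

agreements : ∀ {q n} → Word q n → Word q n → ℕ
agreements x y = count (λ i → does (x i ≟ y i))

dH+agreements≡n : ∀ {q n} (x y : Word q n) → dH x y + agreements x y ≡ n
dH+agreements≡n x y = trans (+-comm (dH x y) _) (count+count-not≡n (λ i → does (x i ≟ y i)))

t≤agreements⇒dH≤n∸t : ∀ {q n t} (x y : Word q n) → t ≤ agreements x y → dH x y ≤ n ∸ t
t≤agreements⇒dH≤n∸t {n = n} {t} x y t≤agree =
  subst (_≤ n ∸ t) dH≡n∸agree (∸-monoʳ-≤ n t≤agree)
  where
  dH≡n∸agree : n ∸ agreements x y ≡ dH x y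
  dH≡n∸agree = trans (cong (_∸ agreements x y) (sym (dH+agreements≡n x y)))
                     (m+n∸n≡m (dH x y) (agreements x y))

dH≤n∸t⇒t≤agreements : ∀ {q n t} (x y : Word q n) → t ≤ n → dH x y ≤ n ∸ t → t ≤ agreements x y
dH≤n∸t⇒t≤agreements {n = n} {t} x y t≤n dH≤n∸t =
  subst₂ _≤_ (m∸[m∸n]≡n t≤n) agree≡n∸dH (∸-monoʳ-≤ n dH≤n∸t)
  where
  agree≡n∸dH : n ∸ dH x y ≡ agreements x y
  agree≡n∸dH = trans (cong (_∸ dH x y) (sym (dH+agreements≡n x y)))
                     (m+n∸m≡n (dH x y) (agreements x y))

hammingCovering-++ : ∀ {q n R N₁ N₂} (c₁ : Fin N₁ → Word q n) (c₂ : Fin N₂ → Word q n) →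
  (∀ x → (∃ λ k → dH x (c₁ k) ≤ R) ⊎ (∃ λ k → dH x (c₂ k) ≤ R)) →
  HammingCovering q n R (N₁ + N₂)
hammingCovering-++ {R = R} {N₁} {N₂} c₁ c₂ covered = tabulate c₁ ++ tabulate c₂ , covering
  where
  covering : ∀ x → ∃ λ k → dH x (lookup (tabulate c₁ ++ tabulate c₂) k) ≤ R
  covering x with covered x
  ... | inj₁ (k , close) = k ↑ˡ N₂ , subst (λ c → dH x c ≤ R)
          (sym (trans (lookup-++ˡ (tabulate c₁) (tabulate c₂) k) (lookup∘tabulate c₁ k))) close
  ... | inj₂ (k , close) = N₁ ↑ʳ k , subst (λ c → dH x c ≤ R)
          (sym (trans (lookup-++ʳ (tabulate c₁) (tabulate c₂) k) (lookup∘tabulate c₂ k))) close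

module _ {q' : ℕ} where

  merge01 : Fin (suc (suc q')) → Fin (suc q')
  merge01 zero = zero
  merge01 (suc zero) = zero
  merge01 (suc (suc a)) = suc a

  bit : Fin (suc (suc q')) → Fin 2
  bit zero = zero
  bit (suc zero) = suc zero
  bit (suc (suc a)) = zero

  bit-↑ˡ : ∀ a → merge01 a ≡ zero → bit a ↑ˡ q' ≡ a
  bit-↑ˡ zero _ = refl
  bit-↑ˡ (suc zero) _ = refl

  merge01≡suc : ∀ a b → merge01 a ≡ suc b → a ≡ suc (suc b)
  merge01≡suc (suc (suc a)) b eq = cong (λ c → suc (suc c)) (suc-injective eq)

hammingCovering-from-coveringArray : ∀ q' t n N → suc q' * t < n →
  IsCoveringArray N (suc t) n 2 → HammingCovering (suc (suc q')) n (n ∸ suc t) (q' + N)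
hammingCovering-from-coveringArray q' t n N [1+q']*t<n (A , A-covers) =
  hammingCovering-++ constant row covered
  where
  constant : Fin q' → Word (suc (suc q')) n
  constant a _ = suc (suc a)

  row : Fin N → Word (suc (suc q')) n
  row r i = A r i ↑ˡ q'

  covered : ∀ x → (∃ λ a → dH x (constant a) ≤ n ∸ suc t) ⊎ (∃ λ r → dH x (row r) ≤ n ∸ suc t)
  covered x with fiber-pigeonhole t (merge01 ∘ x) [1+q']*t<n
  ... | suc a , t<fiber = inj₁ (a , t≤agreements⇒dH≤n∸t x (constant a)
          (≤-trans t<fiber (count-mono _ _ λ i xi∈fiber → dec-true (x i ≟ suc (suc a))
            (merge01≡suc (x i) a (does⇒ (merge01 (x i) ≟ suc a) xi∈fiber)))))
  ... | zero , t<fiber with ≤count⇒injection (fiber (merge01 ∘ x) zero) t<fiber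
  ... | cols , cols-injective , cols∈fiber with A-covers cols cols-injective (bit ∘ x ∘ cols)
  ... | r , r-matches = inj₂ (r , t≤agreements⇒dH≤n∸t x (row r)
          (injection⇒≤count _ cols cols-injective λ a → dec-true (x (cols a) ≟ row r (cols a))
            (sym (trans (cong (_↑ˡ q') (r-matches a))
                        (bit-↑ˡ (x (cols a))
                                (does⇒ (merge01 (x (cols a)) ≟ zero) (cols∈fiber a)))))))

spread : ∀ {q m s} → Word q m → RTWord q m s
spread c i _ = c i

top : ∀ {q m s} → RTWord q m (suc s) → Word q m
top {s = s} x i = x i (fromℕ s)

top∉downClosure : ∀ {q m s} (x y : RTWord q m (suc s)) i →
  top x i ≡ top y i → inDownClosure x y i (fromℕ s) ≡ false
top∉downClosure {s = s} x y i top-agrees =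
  dec-false (any? (λ j → fromℕ s Data.Fin.≤? j ×-dec ¬? (x i j ≟ y i j)))
    λ (j , top≤j , xij≢yij) →
      xij≢yij (subst (λ k → x i k ≡ y i k) (≤-antisym top≤j (≤fromℕ j)) top-agrees)

block-count+top-agreement≤ : ∀ {q m s} (x y : RTWord q m (suc s)) i →
  count (inDownClosure x y i) + indicator (does (top x i ≟ top y i)) ≤ suc s
block-count+top-agreement≤ {s = s} x y i with top x i ≟ top y i
... | no _ = subst (_≤ suc s) (sym (+-identityʳ _)) (count-≤ (inDownClosure x y i))
... | yes top-agrees =
  subst (_≤ suc s) (+-comm 1 (count (inDownClosure x y i)))
        (count-< (inDownClosure x y i) (fromℕ s) (top∉downClosure x y i top-agrees))

dRT+top-agreements≤ : ∀ {q s} m (x y : RTWord q m (suc s)) →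
  dRT x y + agreements (top x) (top y) ≤ m * suc s
dRT+top-agreements≤ zero x y = z≤n
dRT+top-agreements≤ (suc m) x y = begin
  dRT x y + agreements (top x) (top y)
    ≡⟨ cong (dRT x y +_) (count-suc (λ i → does (top x i ≟ top y i))) ⟩
  (count (inDownClosure x y zero) + dRT (x ∘ suc) (y ∘ suc))
    + (indicator (does (top x zero ≟ top y zero)) + agreements (top (x ∘ suc)) (top (y ∘ suc)))
    ≡⟨ interchange (count (inDownClosure x y zero)) _ _ _ ⟩
  (count (inDownClosure x y zero) + indicator (does (top x zero ≟ top y zero)))
    + (dRT (x ∘ suc) (y ∘ suc) + agreements (top (x ∘ suc)) (top (y ∘ suc)))
    ≤⟨ +-mono-≤ (block-count+top-agreement≤ x y zero) (dRT+top-agreements≤ m (x ∘ suc) (y ∘ suc)) ⟩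
  suc m * suc _ ∎
  where open ≤-Reasoning

rtCovering-from-hammingCovering : ∀ {q K} m s t → t ≤ m →
  HammingCovering q m (m ∸ t) K → RTCovering q m (suc s) (m * suc s ∸ t) K
rtCovering-from-hammingCovering {q} m s t t≤m (C , C-covers) = map spread C , covering
  where
  covering : ∀ x → ∃ λ k → dRT x (lookup (map spread C) k) ≤ m * suc s ∸ t
  covering x with C-covers (top x)
  ... | k , close = k , subst (λ c → dRT x c ≤ m * suc s ∸ t) (sym (lookup-map k spread C)) (begin
    dRT x (spread c)                 ≤⟨ m+n≤o⇒m≤o∸n _ (dRT+top-agreements≤ m x (spread c)) ⟩
    m * suc s ∸ agreements (top x) c ≤⟨ ∸-monoʳ-≤ (m * suc s)
                                          (dH≤n∸t⇒t≤agreements (top x) c t≤m close) ⟩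
    m * suc s ∸ t                    ∎)
    where
    c : Word q m
    c = lookup C k
    open ≤-Reasoning

m*[1+n]<[1+n]*[1+m] : ∀ m n → m * suc n < suc n * suc m
m*[1+n]<[1+n]*[1+m] m n rewrite *-comm m (suc n) | *-suc (suc n) m =
  m<n+m (suc n * m) {suc n} (s≤s z≤n)

theorem2 : ∀ (q t s : ℕ) → 2 ≤ q → 2 ≤ t → 1 ≤ s →
    ∀ (K KRT CAN : ℕ) →
    IsKq q ((t ∸ 1) * q) ((t ∸ 1) * q ∸ t) K →
    IsKqRT q ((t ∸ 1) * q) s ((t ∸ 1) * q * s ∸ t) KRT →
    IsCAN t ((t ∸ 1) * q) 2 CAN →
    (K ≤ q ∸ 2 + CAN) × (KRT ≤ K) × (KRT ≤ q ∸ 2 + CAN)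
theorem2 (suc (suc q')) (suc (suc t')) (suc s') _ _ _ K KRT CAN
         (K-covering , K-minimal) (_ , KRT-minimal) (CA , _) =
  K≤q-2+CAN , KRT≤K , ≤-trans KRT≤K K≤q-2+CAN
  where
  n : ℕ
  n = suc t' * suc (suc q')

  t≤n : suc (suc t') ≤ n
  t≤n = +-mono-≤ (s≤s (s≤s z≤n)) (m≤m*n t' (suc (suc q')))

  K≤q-2+CAN : K ≤ q' + CAN
  K≤q-2+CAN = K-minimal (q' + CAN)
    (hammingCovering-from-coveringArray q' (suc t') n CAN (m*[1+n]<[1+n]*[1+m] (suc q') t') CA)

  KRT≤K : KRT ≤ K
  KRT≤K = KRT-minimal K (rtCovering-from-hammingCovering n s' (suc (suc t')) t≤n K-covering)
theorem2 zero _ _ () _ _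
theorem2 (suc zero) _ _ (s≤s ()) _ _
theorem2 (suc (suc _)) zero _ _ () _
theorem2 (suc (suc _)) (suc zero) _ _ (s≤s ()) _
theorem2 (suc (suc _)) (suc (suc _)) zero _ _ ()
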